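{- Let $W$ be the graph with vertex set $\{v_0,v_1,\dots,v_5\}$ and edge multiset consisting of two parallel edges $v_iv_{i+1}$ for each $i=1,\dots,4$, two parallel edges $v_5v_1$, and one edge $v_0v_i$ for each $i=1,\dots,5$ (so every vertex has degree $5$). (i) For any mod $3$-orientation $D$ of $W$, there exists $k\in\{1,\dots,5\}$ such that $v_0v_k$ is the minor-edge at $v_k$ under $D$. (ii) Let $\beta:V(W)\to\mathbb{Z}_3$ be given by $\beta(v_i)=1$ for each $i=0,1,\dots,5$. Then for every $\beta$-orientation $D$ of $W$ there is a vertex $v_j\in V(W)$ with $d^+_D(v_j)=0$ and $d^-_D(v_j)=5$.
   Context: For a boundary function $\beta:V(G)\to\mathbb{Z}_3$ (with $\sum_x\beta(x)=0$ in $\mathbb{Z}_3$), a $\beta$-orientation is an orientation $D$ with $d^+_D(v)-d^-_D(v)\equiv\beta(v)\pmod 3$ for all $v$; a mod $3$-orientation is a $\beta$-orientation with $\beta\equiv 0$. At a vertex $v$ of degree $5$ in a mod $3$-orientation, the edges at $v$ are oriented either $4$ into $v$ and $1$ out of $v$, or $1$ into $v$ and $4$ out of $v$; the minor-edge at $v$ is the unique edge at $v$ whose direction (relative to $v$) differs from the other four. -}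

module Defs where

open import Data.Nat using (ℕ)
open import Data.Integer using (ℤ; _⊖_; _%ℕ_)
open import Data.Fin using (Fin; zero; suc; toℕ; #_; _≟_)
open import Data.Bool using (Bool; true; false)
open import Data.Product using (_×_; _,_; proj₁; proj₂)
open import Data.Vec using (Vec; []; _∷_; lookup)
open import Data.List using (List; length; filter; allFin)
open import Relation.Binary.PropositionalEquality using (_≡_; _≢_)
open import Data.Sum using (_⊎_)
open import Relation.Nullary using (¬_)

-- Vertices of W: Fin 6, where index i stands for v_i (v_0 is the hub).
V : Set
V = Fin 6

E : Set
E = Fin 15

endpoints : Vec (V × V) 15
endpoints =
  (# 1 , # 2) ∷ (# 1 , # 2) ∷ (# 2 , # 3) ∷ (# 2 , # 3) ∷ (# 3 , # 4) ∷
  (# 3 , # 4) ∷ (# 4 , # 5) ∷ (# 4 , # 5) ∷ (# 5 , # 1) ∷ (# 5 , # 1) ∷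
  (# 0 , # 1) ∷ (# 0 , # 2) ∷ (# 0 , # 3) ∷ (# 0 , # 4) ∷ (# 0 , # 5) ∷ []

end₁ end₂ : E → V
end₁ e = proj₁ (lookup endpoints e)
end₂ e = proj₂ (lookup endpoints e)

-- The spoke edge v0 v_k, for k = 1..5 given as Fin 5 (k = suc j).
spoke : Fin 5 → E
spoke j = lookup (# 10 ∷ # 11 ∷ # 12 ∷ # 13 ∷ # 14 ∷ []) j

rim : Fin 5 → V
rim j = suc j

-- An orientation of W: for each edge, true means end₁ → end₂,
-- false means end₂ → end₁.
Orientation : Set
Orientation = E → Bool

tail head : Orientation → E → V
tail D e with D e
... | true  = end₁ e
... | false = end₂ e
head D e with D e
... | true  = end₂ e
... | false = end₁ e

outdeg indeg : Orientation → V → ℕ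
outdeg D x = length (filter (λ e → tail D e ≟ x) (allFin 15))
indeg  D x = length (filter (λ e → head D e ≟ x) (allFin 15))

IsBetaOrientation : (V → Fin 3) → Orientation → Set
IsBetaOrientation β D = ∀ x → (outdeg D x ⊖ indeg D x) %ℕ 3 ≡ toℕ (β x)

IsMod3Orientation : Orientation → Set
IsMod3Orientation = IsBetaOrientation (λ _ → zero)

Incident : V → E → Set
Incident x e = (end₁ e ≡ x) ⊎ (end₂ e ≡ x)

-- e is oriented out of x (meaningful when e is incident with x; W is loopless)
OutOf : Orientation → V → E → Set
OutOf D x e = tail D e ≡ x

-- e is the minor-edge at x: e is at x and its direction relative to x
-- differs from that of every other edge e′ at x, i.e.
-- (e′ out of x) ⇔ ¬ (e out of x).
IsMinorEdge : Orientation → V → E → Set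
IsMinorEdge D x e =
  Incident x e ×
  (∀ e′ → e′ ≢ e → Incident x e′ →
     (OutOf D x e′ → ¬ OutOf D x e) × (¬ OutOf D x e → OutOf D x e′))

-- W has only 2^15 orientations and both properties are decidable for a single
-- orientation, so the theorem is settled by exhaustive evaluation. Orientations
-- are functions, so each one is first replaced by the tabulation of its values;
-- the degrees, β-orientations and minor-edges only depend on those values.
module Submission where

open import Defs
open import Data.Fin using (Fin; #_)
open import Data.Nat using (ℕ)
open import Data.Product using (_×_; ∃-syntax)
open import Relation.Binary.PropositionalEquality using (_≡_)

open import Data.Bool using (Bool; true; false)
open import Data.Fin using (toℕ; _≟_)
open import Data.Fin.Properties using (all?; any?)
open import Data.Integer using (_⊖_; _%ℕ_)
open import Data.List using (filter; length; allFin)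
open import Data.List.Properties using (filter-≐)
import Data.Nat as ℕ
open import Data.Product using (_,_; proj₁; proj₂)
open import Data.Vec using (Vec; []; _∷_; lookup; tabulate)
open import Data.Vec.Properties using (lookup∘tabulate)
open import Function using (_∘_)
open import Relation.Binary.PropositionalEquality using (refl; sym; trans; cong; _≗_)
open import Relation.Nullary using (Dec; ¬?)
open import Relation.Nullary.Decidable
  using (True; toWitness; map′; _×-dec_; _⊎-dec_; _→-dec_)

∀-Vec? : ∀ {n p} {P : Vec Bool n → Set p} →
         (∀ v → Dec (P v)) → Dec (∀ v → P v)
∀-Vec? {ℕ.zero} P? = map′ (λ { p [] → p }) (λ ∀p → ∀p []) (P? [])
∀-Vec? {ℕ.suc n} P? =
  map′ (λ { (ptrue , pfalse) (true ∷ v) → ptrue v ; (ptrue , pfalse) (false ∷ v) → pfalse v })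
       (λ ∀p → (λ v → ∀p (true ∷ v)) , (λ v → ∀p (false ∷ v)))
       (∀-Vec? (λ v → P? (true ∷ v)) ×-dec ∀-Vec? (λ v → P? (false ∷ v)))

∀-by-tabulation : ∀ {n p} {P : (Fin n → Bool) → Set p} →
                  (∀ {f g} → f ≗ g → P f → P g) →
                  (P? : ∀ f → Dec (P f)) → True (∀-Vec? (P? ∘ lookup)) →
                  ∀ f → P f
∀-by-tabulation resp P? checked f =
  resp (lookup∘tabulate f) (toWitness checked (tabulate f))

module _ {D D′ : Orientation} (D≗D′ : D ≗ D′) where

  tail-cong : tail D ≗ tail D′
  tail-cong e with D e | D′ e | D≗D′ e
  ... | true  | .true  | refl = refl
  ... | false | .false | refl = refl

  head-cong : head D ≗ head D′
  head-cong e with D e | D′ e | D≗D′ e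
  ... | true  | .true  | refl = refl
  ... | false | .false | refl = refl

  outdeg-cong : outdeg D ≗ outdeg D′
  outdeg-cong x = cong length (filter-≐ (λ e → tail D e ≟ x) (λ e → tail D′ e ≟ x)
    ((λ {e} → trans (sym (tail-cong e))) , (λ {e} → trans (tail-cong e)))
    (allFin 15))

  indeg-cong : indeg D ≗ indeg D′
  indeg-cong x = cong length (filter-≐ (λ e → head D e ≟ x) (λ e → head D′ e ≟ x)
    ((λ {e} → trans (sym (head-cong e))) , (λ {e} → trans (head-cong e)))
    (allFin 15))

  isBetaOrientation-cong : ∀ β → IsBetaOrientation β D → IsBetaOrientation β D′
  isBetaOrientation-cong β isβ x
    rewrite sym (outdeg-cong x) | sym (indeg-cong x) = isβ x

  isMinorEdge-cong : ∀ x e → IsMinorEdge D x e → IsMinorEdge D′ x e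
  isMinorEdge-cong x e (incident , opposite) = incident , λ e′ e′≢e incident′ →
    (λ out′ out → proj₁ (opposite e′ e′≢e incident′)
                    (trans (tail-cong e′) out′) (trans (tail-cong e) out)) ,
    (λ ¬out → trans (sym (tail-cong e′))
                (proj₂ (opposite e′ e′≢e incident′) (¬out ∘ trans (sym (tail-cong e)))))

incident? : ∀ x e → Dec (Incident x e)
incident? x e = (end₁ e ≟ x) ⊎-dec (end₂ e ≟ x)

isMinorEdge? : ∀ D x e → Dec (IsMinorEdge D x e)
isMinorEdge? D x e = incident? x e ×-dec all? λ e′ →
  ¬? (e′ ≟ e) →-dec incident? x e′ →-dec
    ((out? e′ →-dec ¬? (out? e)) ×-dec (¬? (out? e) →-dec out? e′))
  where
  out? : ∀ e → Dec (OutOf D x e)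
  out? e = tail D e ≟ x

isBetaOrientation? : ∀ β D → Dec (IsBetaOrientation β D)
isBetaOrientation? β D = all? λ x → (outdeg D x ⊖ indeg D x) %ℕ 3 ℕ.≟ toℕ (β x)

HasMinorSpoke : Orientation → Set
HasMinorSpoke D = ∃[ j ] IsMinorEdge D (rim j) (spoke j)

HasSink : Orientation → Set
HasSink D = ∃[ x ] (outdeg D x ≡ 0 × indeg D x ≡ 5)

mod3-hasMinorSpoke : (D : Orientation) → IsMod3Orientation D → HasMinorSpoke D
mod3-hasMinorSpoke = ∀-by-tabulation
  (λ D≗D′ mod3⇒spoke mod3′ →
     let j , minor = mod3⇒spoke (isBetaOrientation-cong (sym ∘ D≗D′) _ mod3′)
     in  j , isMinorEdge-cong D≗D′ _ _ minor)
  (λ D → isBetaOrientation? _ D →-dec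
           any? λ j → isMinorEdge? D (rim j) (spoke j))
  _

β≡1-hasSink : (D : Orientation) → IsBetaOrientation (λ _ → # 1) D → HasSink D
β≡1-hasSink = ∀-by-tabulation
  (λ D≗D′ β⇒sink β′ →
     let x , out≡0 , in≡5 = β⇒sink (isBetaOrientation-cong (sym ∘ D≗D′) _ β′)
     in  x , trans (sym (outdeg-cong D≗D′ x)) out≡0 , trans (sym (indeg-cong D≗D′ x)) in≡5)
  (λ D → isBetaOrientation? _ D →-dec
           any? λ x → (outdeg D x ℕ.≟ 0) ×-dec (indeg D x ℕ.≟ 5))
  _

lemma2p2 :
    ((D : Orientation) → IsMod3Orientation D →
      ∃[ j ] IsMinorEdge D (rim j) (spoke j))
    ×
    ((D : Orientation) → IsBetaOrientation (λ _ → # 1) D →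
      ∃[ x ] (outdeg D x ≡ 0 × indeg D x ≡ 5))
lemma2p2 = mod3-hasMinorSpoke , β≡1-hasSink
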